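{- Let $q>3$ be a prime power and let $(\rho_0,\rho_1,\rho_2,\rho_3)$ be a string representation of rank $4$ of ${\rm PSL}_2(q)$. Then for every $i\in\{0,1,2\}$ the element $\rho_i\rho_{i+1}$ has order greater than $2$.
   Context: A string representation of rank $n$ of a group $G$ is an $n$-tuple $(g_0,\ldots,g_{n-1})$ of pairwise distinct involutions of $G$ that generate $G$ and satisfy $g_ig_j=g_jg_i$ whenever $|i-j|>1$. -}

module Defs where

open import Level using (Level; _⊔_; 0ℓ) renaming (suc to lsuc)
open import Algebra.Bundles using (CommutativeRing)
open import Data.Nat using (ℕ; zero; suc; _<_; _≤_; _^_)
open import Data.Nat.Primality using (Prime)
open import Data.Fin using (Fin; toℕ; inject₁) renaming (suc to fsuc)
open import Data.Product using (Σ; ∃; _×_; _,_)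
open import Data.Sum using (_⊎_)
open import Relation.Nullary using (¬_)
open import Relation.Binary.PropositionalEquality using (_≡_)

IsPrimePower : ℕ → Set
IsPrimePower q = Σ ℕ λ p → Σ ℕ λ k → Prime p × 1 ≤ k × q ≡ p ^ k

record Field (c ℓ : Level) : Set (lsuc (c ⊔ ℓ)) where
  field
    commutativeRing : CommutativeRing c ℓ
  open CommutativeRing commutativeRing public
  field
    1≉0     : ¬ (1# ≈ 0#)
    inverse : ∀ x → ¬ (x ≈ 0#) → Σ Carrier λ y → x * y ≈ 1#

HasCardinality : ∀ {c ℓ} → Field c ℓ → ℕ → Set (c ⊔ ℓ)
HasCardinality F q =
  Σ (Fin q → Carrier) λ e →
    (∀ i j → e i ≈ e j → i ≡ j) × (∀ x → Σ (Fin q) λ i → e i ≈ x)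
  where open Field F

-- PSL₂(F) = SL₂(F) / {±I}.  Elements are represented by 2×2 matrices of
-- determinant 1; two such matrices represent the same element of PSL₂(F)
-- iff M = N or M = -N.
module PSL2 {c ℓ} (F : Field c ℓ) where
  open Field F

  record Mat : Set c where
    constructor mat
    field
      a b c' d : Carrier
  open Mat public

  det : Mat → Carrier
  det M = (a M * d M) - (b M * c' M)

  InSL : Mat → Set ℓ
  InSL M = det M ≈ 1#

  _∼_ : Mat → Mat → Set ℓ
  M ∼ N = (a M ≈ a N × b M ≈ b N × c' M ≈ c' N × d M ≈ d N)
        ⊎ (a M ≈ - a N × b M ≈ - b N × c' M ≈ - c' N × d M ≈ - d N)

  I : Mat
  I = mat 1# 0# 0# 1#

  _·_ : Mat → Mat → Mat
  M · N = mat (a M * a N + b M * c' N) (a M * b N + b M * d N)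
              (c' M * a N + d M * c' N) (c' M * b N + d M * d N)

  -- inverse of a determinant-one matrix (the adjugate)
  inv : Mat → Mat
  inv M = mat (d M) (- b M) (- c' M) (a M)

  pow : Mat → ℕ → Mat
  pow g zero = I
  pow g (suc n) = g · pow g n

  IsInvolution : Mat → Set ℓ
  IsInvolution g = (g · g) ∼ I × ¬ (g ∼ I)

  data Generated {n : ℕ} (ρ : Fin n → Mat) : Mat → Set (c ⊔ ℓ) where
    gen  : ∀ i → Generated ρ (ρ i)
    one  : Generated ρ I
    mul  : ∀ {g h} → Generated ρ g → Generated ρ h → Generated ρ (g · h)
    inv' : ∀ {g} → Generated ρ g → Generated ρ (inv g)
    resp : ∀ {g h} → g ∼ h → Generated ρ g → Generated ρ h

  Generates : {n : ℕ} → (Fin n → Mat) → Set (c ⊔ ℓ)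
  Generates ρ = ∀ M → InSL M → Generated ρ M

  IsStringRep : (n : ℕ) → (Fin n → Mat) → Set (c ⊔ ℓ)
  IsStringRep n ρ =
      (∀ i → InSL (ρ i))
    × (∀ i → IsInvolution (ρ i))
    × (∀ i j → ¬ (i ≡ j) → ¬ (ρ i ∼ ρ j))
    × Generates ρ
    × (∀ i j → suc (toℕ i) < toℕ j ⊎ suc (toℕ j) < toℕ i → (ρ i · ρ j) ∼ (ρ j · ρ i))

  OrderGreaterThan : Mat → ℕ → Set ℓ
  OrderGreaterThan g m = ∀ n → 1 ≤ n → n ≤ m → ¬ (pow g n ∼ I)

-- Adjacent generators ρᵢ, ρᵢ₊₁ are
-- distinct involutions, so ρᵢρᵢ₊₁ can only have order 1 or 2 if they commute. If ρ₀
-- commuted with ρ₁ it would commute with every generator, hence be central; but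
-- commuting with [[1,1],[0,1]] and its transpose forces a scalar matrix. The same
-- argument applies to ρ₃ if ρ₂ and ρ₃ commute.
-- For ρ₁ and ρ₂: an involution is traceless, [[a,b],[c,-a]] with a² + bc = -1, and two
-- distinct ones [[a,b],[c,-a]], [[e,f],[g,-e]] can only commute up to sign by
-- anticommuting, i.e. by being orthogonal for the polar form 2ae + bg + cf of a² + bc.
-- In odd characteristic this form is nondegenerate, so ρ₂ and ρ₃, both orthogonal to
-- the independent ρ₀ and ρ₁, are proportional and hence equal up to sign. In
-- characteristic 2 commuting means (b, c) ∥ (f, g), which is transitive through the
-- non-scalar ρ₂, so ρ₀ would commute with ρ₁.

module Submission where

open import Level using (0ℓ)
open import Algebra.Bundles using (CommutativeRing; Monoid)
import Algebra.Solver.Ring.AlmostCommutativeRing as ACR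
open import Data.Empty using (⊥-elim)
open import Data.Fin as Fin using (Fin; zero; inject₁) renaming (suc to fsuc)
import Data.Fin.Properties as Fin
open import Data.Integer as ℤ using (ℤ; +_; -[1+_]; _⊖_; sign; ∣_∣)
import Data.Integer.Properties as ℤ
open import Data.Maybe using (Maybe; just; nothing)
open import Data.Nat as ℕ using (ℕ; zero; suc; _<_)
import Data.Nat.Properties as ℕ
open import Data.Product using (Σ; _×_; _,_; proj₁; proj₂)
open import Data.Sign as Sign using (Sign)
open import Data.Sum using (_⊎_; inj₁; inj₂)
open import Data.Vec.Functional using (Vector; []; _∷_)
open import Relation.Binary.Definitions using (Decidable)
open import Relation.Binary.PropositionalEquality as ≡ using (_≡_)
open import Relation.Nullary using (¬_; yes; no)

open import Defs

module IntegerCoefficientSolver {c ℓ} (R : CommutativeRing c ℓ) where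
  open CommutativeRing R
  open import Relation.Binary.Reasoning.Setoid setoid
  open import Algebra.Properties.Ring ring using (-‿involutive; -0#≈0#; -1*x≈-x; -‿distribʳ-*)
  open import Algebra.Properties.AbelianGroup +-abelianGroup using (⁻¹-∙-comm)
  open import Algebra.Properties.CommutativeSemigroup +-commutativeSemigroup
    using () renaming (interchange to +-interchange)
  open import Algebra.Properties.CommutativeSemigroup *-commutativeSemigroup
    using () renaming (interchange to *-interchange)
  open import Algebra.Properties.Semiring.Mult.TCOptimised semiring
    using (1+×; ×-homo-+; ×1-homo-*) renaming (_×_ to _×ℕ_)

  -- With the optimised _×_, fromℕ 1 is 1# and fromℕ 2 is 1# + 1# definitionally, so the
  -- solver constants con (+ 1) and con (+ 2) stand for 1# and 2#.
  fromℕ : ℕ → Carrier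
  fromℕ n = n ×ℕ 1#

  fromℤ : ℤ → Carrier
  fromℤ (+ n)      = fromℕ n
  fromℤ -[1+ n ]   = - fromℕ (suc n)

  fromSign : Sign → Carrier
  fromSign Sign.+ = 1#
  fromSign Sign.- = - 1#

  fromℤ-⊖ : ∀ m n → fromℤ (m ⊖ n) ≈ fromℕ m - fromℕ n
  fromℤ-⊖ m zero = begin
    fromℤ (m ⊖ 0)  ≡⟨ ≡.cong fromℤ (ℤ.⊖-≥ {m} ℕ.z≤n) ⟩
    fromℕ m        ≈⟨ +-identityʳ (fromℕ m) ⟨
    fromℕ m + 0#   ≈⟨ +-congˡ -0#≈0# ⟨
    fromℕ m - 0#   ∎
  fromℤ-⊖ zero (suc n) = begin
    fromℤ (0 ⊖ suc n)     ≡⟨ ≡.cong fromℤ (ℤ.⊖-< {0} {suc n} (ℕ.s≤s ℕ.z≤n)) ⟩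
    - fromℕ (suc n)       ≈⟨ +-identityˡ _ ⟨
    0# - fromℕ (suc n)    ∎
  fromℤ-⊖ (suc m) (suc n) = begin
    fromℤ (suc m ⊖ suc n)               ≡⟨ ≡.cong fromℤ (ℤ.[1+m]⊖[1+n]≡m⊖n m n) ⟩
    fromℤ (m ⊖ n)                       ≈⟨ fromℤ-⊖ m n ⟩
    fromℕ m - fromℕ n                   ≈⟨ +-identityˡ _ ⟨
    0# + (fromℕ m - fromℕ n)            ≈⟨ +-congʳ (-‿inverseʳ 1#) ⟨
    (1# - 1#) + (fromℕ m - fromℕ n)     ≈⟨ +-interchange 1# (- 1#) (fromℕ m) (- fromℕ n) ⟩
    (1# + fromℕ m) + (- 1# - fromℕ n)   ≈⟨ +-congˡ (⁻¹-∙-comm 1# (fromℕ n)) ⟩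
    (1# + fromℕ m) - (1# + fromℕ n)     ≈⟨ +-cong (1+× m 1#) (-‿cong (1+× n 1#)) ⟨
    fromℕ (suc m) - fromℕ (suc n)       ∎

  fromℤ-+ : ∀ i j → fromℤ (i ℤ.+ j) ≈ fromℤ i + fromℤ j
  fromℤ-+ (+ m)      (+ n)      = ×-homo-+ 1# m n
  fromℤ-+ (+ m)      -[1+ n ]   = fromℤ-⊖ m (suc n)
  fromℤ-+ -[1+ m ]   (+ n)      = trans (fromℤ-⊖ n (suc m)) (+-comm _ _)
  fromℤ-+ -[1+ m ]   -[1+ n ]   = begin
    - fromℕ (suc (suc (m ℕ.+ n)))        ≡⟨ ≡.cong (λ k → - fromℕ (suc k)) (ℕ.+-suc m n) ⟨
    - fromℕ (suc m ℕ.+ suc n)            ≈⟨ -‿cong (×-homo-+ 1# (suc m) (suc n)) ⟩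
    - (fromℕ (suc m) + fromℕ (suc n))    ≈⟨ ⁻¹-∙-comm _ _ ⟨
    - fromℕ (suc m) - fromℕ (suc n)      ∎

  fromℤ-neg : ∀ i → fromℤ (ℤ.- i) ≈ - fromℤ i
  fromℤ-neg (+ zero)   = sym -0#≈0#
  fromℤ-neg (+ suc n)  = refl
  fromℤ-neg -[1+ n ]   = sym (-‿involutive _)

  fromSign-* : ∀ s t → fromSign (s Sign.* t) ≈ fromSign s * fromSign t
  fromSign-* Sign.+ t        = sym (*-identityˡ _)
  fromSign-* Sign.- Sign.+   = sym (*-identityʳ _)
  fromSign-* Sign.- Sign.-   = begin
    1#             ≈⟨ -‿involutive 1# ⟨
    - - 1#         ≈⟨ -‿cong (*-identityʳ _) ⟨
    - (- 1# * 1#)  ≈⟨ -‿distribʳ-* _ _ ⟩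
    - 1# * - 1#    ∎

  fromℤ-◃ : ∀ s n → fromℤ (s ℤ.◃ n) ≈ fromSign s * fromℕ n
  fromℤ-◃ s       zero    = sym (zeroʳ _)
  fromℤ-◃ Sign.+  (suc n) = sym (*-identityˡ _)
  fromℤ-◃ Sign.-  (suc n) = sym (-1*x≈-x _)

  fromℤ-sign-abs : ∀ i → fromℤ i ≈ fromSign (sign i) * fromℕ ∣ i ∣
  fromℤ-sign-abs (+ n)      = sym (*-identityˡ _)
  fromℤ-sign-abs -[1+ n ]   = sym (-1*x≈-x _)

  fromℤ-* : ∀ i j → fromℤ (i ℤ.* j) ≈ fromℤ i * fromℤ j
  fromℤ-* i j = begin
    fromℤ (i ℤ.* j)
      ≈⟨ fromℤ-◃ _ (∣ i ∣ ℕ.* ∣ j ∣) ⟩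
    fromSign (sign i Sign.* sign j) * fromℕ (∣ i ∣ ℕ.* ∣ j ∣)
      ≈⟨ *-cong (fromSign-* (sign i) (sign j)) (×1-homo-* ∣ i ∣ ∣ j ∣) ⟩
    (fromSign (sign i) * fromSign (sign j)) * (fromℕ ∣ i ∣ * fromℕ ∣ j ∣)
      ≈⟨ *-interchange _ _ _ _ ⟩
    (fromSign (sign i) * fromℕ ∣ i ∣) * (fromSign (sign j) * fromℕ ∣ j ∣)
      ≈⟨ *-cong (fromℤ-sign-abs i) (fromℤ-sign-abs j) ⟨
    fromℤ i * fromℤ j
      ∎

  fromℤ-homomorphism : ℤ.+-*-rawRing ACR.-Raw-AlmostCommutative⟶ ACR.fromCommutativeRing R
  fromℤ-homomorphism = record
    { ⟦_⟧ = fromℤ ; +-homo = fromℤ-+ ; *-homo = fromℤ-* ; -‿homo = fromℤ-neg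
    ; 0-homo = refl ; 1-homo = refl }

  fromℤ-≟ : ∀ i j → Maybe (fromℤ i ≈ fromℤ j)
  fromℤ-≟ i j with i ℤ.≟ j
  ... | yes ≡.refl = just refl
  ... | no _       = nothing

  open import Algebra.Solver.Ring ℤ.+-*-rawRing (ACR.fromCommutativeRing R) fromℤ-homomorphism fromℤ-≟ public

module CommutingElements {c ℓ} (M : Monoid c ℓ) where
  open Monoid M
  open import Algebra.Properties.Monoid M using (cancelʳ; insertˡ; insertʳ; cancelᶜ)
  open import Relation.Binary.Reasoning.Setoid setoid

  private variable x x′ y y′ z : Carrier

  Commute : Carrier → Carrier → Set ℓ
  Commute x y = x ∙ y ≈ y ∙ x

  commute-resp : x ≈ x′ → y ≈ y′ → Commute x y → Commute x′ y′
  commute-resp x≈x′ y≈y′ xy≈yx = trans (∙-cong (sym x≈x′) (sym y≈y′)) (trans xy≈yx (∙-cong y≈y′ x≈x′))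

  commute-ε : Commute x ε
  commute-ε {x} = trans (identityʳ x) (sym (identityˡ x))

  commute-∙ : Commute x y → Commute x z → Commute x (y ∙ z)
  commute-∙ {x} {y} {z} xy≈yx xz≈zx = begin
    x ∙ (y ∙ z)  ≈⟨ assoc x y z ⟨
    (x ∙ y) ∙ z  ≈⟨ ∙-congʳ xy≈yx ⟩
    (y ∙ x) ∙ z  ≈⟨ assoc y x z ⟩
    y ∙ (x ∙ z)  ≈⟨ ∙-congˡ xz≈zx ⟩
    y ∙ (z ∙ x)  ≈⟨ assoc y z x ⟨
    (y ∙ z) ∙ x  ∎

  commute-inverse : y′ ∙ y ≈ ε → y ∙ y′ ≈ ε → Commute x y → Commute x y′
  commute-inverse {y′} {y} {x} y′y≈ε yy′≈ε xy≈yx = begin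
    x ∙ y′                ≈⟨ insertˡ y′y≈ε (x ∙ y′) ⟩
    y′ ∙ (y ∙ (x ∙ y′))   ≈⟨ ∙-congˡ (assoc y x y′) ⟨
    y′ ∙ ((y ∙ x) ∙ y′)   ≈⟨ ∙-congˡ (∙-congʳ xy≈yx) ⟨
    y′ ∙ ((x ∙ y) ∙ y′)   ≈⟨ ∙-congˡ (cancelʳ yy′≈ε x) ⟩
    y′ ∙ x                ∎

  ∙≈ε⇒≈ : y ∙ y ≈ ε → x ∙ y ≈ ε → x ≈ y
  ∙≈ε⇒≈ {y} {x} yy≈ε xy≈ε = begin
    x            ≈⟨ insertʳ yy≈ε x ⟩
    (x ∙ y) ∙ y  ≈⟨ ∙-congʳ xy≈ε ⟩
    ε ∙ y        ≈⟨ identityˡ y ⟩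
    y            ∎

  involutions-commute : x ∙ x ≈ ε → y ∙ y ≈ ε → (x ∙ y) ∙ (x ∙ y) ≈ ε → Commute x y
  involutions-commute {x} {y} xx≈ε yy≈ε xyxy≈ε = sym (begin
    y ∙ x                      ≈⟨ insertʳ xyxy≈ε (y ∙ x) ⟩
    ((y ∙ x) ∙ (x ∙ y)) ∙ (x ∙ y) ≈⟨ ∙-congʳ (cancelᶜ xx≈ε y y) ⟩
    (y ∙ y) ∙ (x ∙ y)          ≈⟨ ∙-congʳ yy≈ε ⟩
    ε ∙ (x ∙ y)                ≈⟨ identityˡ (x ∙ y) ⟩
    x ∙ y                      ∎)

pattern 0F = zero
pattern 1F = fsuc zero
pattern 2F = fsuc (fsuc zero)
pattern 3F = fsuc (fsuc (fsuc zero))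

module ThreeVectors {c ℓ} (R : CommutativeRing c ℓ) where
  open CommutativeRing R
  open IntegerCoefficientSolver R
  open import Algebra.Properties.Group +-group using () renaming (x∙y⁻¹≈ε⇒x≈y to x-y≈0⇒x≈y)
  open import Relation.Binary.Reasoning.Setoid setoid

  private variable u v : Vector Carrier 3

  dot : Vector Carrier 3 → Vector Carrier 3 → Carrier
  dot u v = u 0F * v 0F + u 1F * v 1F + u 2F * v 2F

  cross : Vector Carrier 3 → Vector Carrier 3 → Vector Carrier 3
  cross u v = (u 1F * v 2F - u 2F * v 1F) ∷ (u 2F * v 0F - u 0F * v 2F) ∷ (u 0F * v 1F - u 1F * v 0F) ∷ []

  record Parallel (u v : Vector Carrier 3) : Set ℓ where
    constructor parallel
    field cross≈0 : ∀ k → cross u v k ≈ 0#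

  parallel⇒*≈* : Parallel u v → ∀ i j → u i * v j ≈ u j * v i
  parallel⇒*≈* (parallel u×v≈0) 0F 0F = refl
  parallel⇒*≈* (parallel u×v≈0) 1F 1F = refl
  parallel⇒*≈* (parallel u×v≈0) 2F 2F = refl
  parallel⇒*≈* (parallel u×v≈0) 1F 2F = x-y≈0⇒x≈y _ _ (u×v≈0 0F)
  parallel⇒*≈* (parallel u×v≈0) 2F 0F = x-y≈0⇒x≈y _ _ (u×v≈0 1F)
  parallel⇒*≈* (parallel u×v≈0) 0F 1F = x-y≈0⇒x≈y _ _ (u×v≈0 2F)
  parallel⇒*≈* (parallel u×v≈0) 2F 1F = sym (x-y≈0⇒x≈y _ _ (u×v≈0 0F))
  parallel⇒*≈* (parallel u×v≈0) 0F 2F = sym (x-y≈0⇒x≈y _ _ (u×v≈0 1F))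
  parallel⇒*≈* (parallel u×v≈0) 1F 0F = sym (x-y≈0⇒x≈y _ _ (u×v≈0 2F))

  cross-cross : ∀ p q w k → cross (cross p q) w k ≈ q k * dot p w - p k * dot q w
  cross-cross p q w 0F = solve 9 (λ p₀ p₁ p₂ q₀ q₁ q₂ w₀ w₁ w₂ →
    (p₂ :* q₀ :- p₀ :* q₂) :* w₂ :- (p₀ :* q₁ :- p₁ :* q₀) :* w₁
      := q₀ :* (p₀ :* w₀ :+ p₁ :* w₁ :+ p₂ :* w₂) :- p₀ :* (q₀ :* w₀ :+ q₁ :* w₁ :+ q₂ :* w₂))
    refl (p 0F) (p 1F) (p 2F) (q 0F) (q 1F) (q 2F) (w 0F) (w 1F) (w 2F)
  cross-cross p q w 1F = solve 9 (λ p₀ p₁ p₂ q₀ q₁ q₂ w₀ w₁ w₂ →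
    (p₀ :* q₁ :- p₁ :* q₀) :* w₀ :- (p₁ :* q₂ :- p₂ :* q₁) :* w₂
      := q₁ :* (p₀ :* w₀ :+ p₁ :* w₁ :+ p₂ :* w₂) :- p₁ :* (q₀ :* w₀ :+ q₁ :* w₁ :+ q₂ :* w₂))
    refl (p 0F) (p 1F) (p 2F) (q 0F) (q 1F) (q 2F) (w 0F) (w 1F) (w 2F)
  cross-cross p q w 2F = solve 9 (λ p₀ p₁ p₂ q₀ q₁ q₂ w₀ w₁ w₂ →
    (p₁ :* q₂ :- p₂ :* q₁) :* w₁ :- (p₂ :* q₀ :- p₀ :* q₂) :* w₀
      := q₂ :* (p₀ :* w₀ :+ p₁ :* w₁ :+ p₂ :* w₂) :- p₂ :* (q₀ :* w₀ :+ q₁ :* w₁ :+ q₂ :* w₂))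
    refl (p 0F) (p 1F) (p 2F) (q 0F) (q 1F) (q 2F) (w 0F) (w 1F) (w 2F)

  parallel-cross : ∀ {p q w} → dot p w ≈ 0# → dot q w ≈ 0# → Parallel (cross p q) w
  parallel-cross {p} {q} {w} p·w≈0 q·w≈0 = parallel λ k → begin
    cross (cross p q) w k           ≈⟨ cross-cross p q w k ⟩
    q k * dot p w - p k * dot q w   ≈⟨ +-cong (*-congˡ p·w≈0) (-‿cong (*-congˡ q·w≈0)) ⟩
    q k * 0# - p k * 0#             ≈⟨ solve 2 (λ x y → x :* con (+ 0) :- y :* con (+ 0) := con (+ 0)) refl (q k) (p k) ⟩
    0#                              ∎

module FieldProperties {c ℓ} (F : Field c ℓ) where
  open Field F
  open IntegerCoefficientSolver commutativeRing
  open ThreeVectors commutativeRing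
  open import Algebra.Properties.Group +-group using ()
    renaming (x∙y⁻¹≈ε⇒x≈y to x-y≈0⇒x≈y; x≈y⇒x∙y⁻¹≈ε to x≈y⇒x-y≈0; inverseˡ-unique to x+y≈0⇒x≈-y)
  open import Relation.Binary.Reasoning.Setoid setoid

  private variable x y : Carrier

  2# : Carrier
  2# = 1# + 1#

  x≈-y⇒x+y≈0 : x ≈ - y → x + y ≈ 0#
  x≈-y⇒x+y≈0 {y = y} x≈-y = trans (+-congʳ x≈-y) (-‿inverseˡ y)

  x*y≈0⇒y≈0 : ¬ x ≈ 0# → x * y ≈ 0# → y ≈ 0#
  x*y≈0⇒y≈0 {x} {y} x≉0 xy≈0 with inverse x x≉0
  ... | x⁻¹ , xx⁻¹≈1 = begin
    y                ≈⟨ *-identityˡ y ⟨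
    1# * y           ≈⟨ *-congʳ xx⁻¹≈1 ⟨
    (x * x⁻¹) * y    ≈⟨ solve 3 (λ x x⁻¹ y → (x :* x⁻¹) :* y := x⁻¹ :* (x :* y)) refl x x⁻¹ y ⟩
    x⁻¹ * (x * y)    ≈⟨ *-congˡ xy≈0 ⟩
    x⁻¹ * 0#         ≈⟨ zeroʳ x⁻¹ ⟩
    0#               ∎

  x+x≈0⇒x≈0 : ¬ 2# ≈ 0# → x + x ≈ 0# → x ≈ 0#
  x+x≈0⇒x≈0 {x} 2≉0 x+x≈0 =
    x*y≈0⇒y≈0 2≉0 (trans (solve 1 (λ x → con (+ 2) :* x := x :+ x) refl x) x+x≈0)

  2≈0⇒x≈-x : 2# ≈ 0# → x ≈ - x
  2≈0⇒x≈-x {x} 2≈0 = x+y≈0⇒x≈-y x x (begin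
    x + x      ≈⟨ solve 1 (λ x → x :+ x := con (+ 2) :* x) refl x ⟩
    2# * x     ≈⟨ *-congʳ 2≈0 ⟩
    0# * x     ≈⟨ zeroˡ x ⟩
    0#         ∎)

  x*x≈1⇒x≈±1 : Decidable _≈_ → x * x ≈ 1# → x ≈ 1# ⊎ x ≈ - 1#
  x*x≈1⇒x≈±1 {x} _≟_ xx≈1 with (x - 1#) ≟ 0#
  ... | yes x-1≈0 = inj₁ (x-y≈0⇒x≈y x 1# x-1≈0)
  ... | no  x-1≉0 = inj₂ (x+y≈0⇒x≈-y x 1# (x*y≈0⇒y≈0 x-1≉0 (begin
    (x - 1#) * (x + 1#)  ≈⟨ solve 1 (λ x → (x :- con (+ 1)) :* (x :+ con (+ 1)) := x :* x :- con (+ 1)) refl x ⟩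
    x * x - 1#           ≈⟨ x≈y⇒x-y≈0 xx≈1 ⟩
    0#                   ∎)))

  parallel-trans : ∀ {u v w} k → ¬ u k ≈ 0# → Parallel u v → Parallel u w → Parallel v w
  parallel-trans {u} {v} {w} k uₖ≉0 u∥v u∥w = parallel λ where
      0F → x≈y⇒x-y≈0 (v*w-symmetric 1F 2F)
      1F → x≈y⇒x-y≈0 (v*w-symmetric 2F 0F)
      2F → x≈y⇒x-y≈0 (v*w-symmetric 0F 1F)
    where
    v*w-symmetric : ∀ i j → v i * w j ≈ v j * w i
    v*w-symmetric i j = x-y≈0⇒x≈y _ _ (x*y≈0⇒y≈0 uₖ≉0 (x*y≈0⇒y≈0 uₖ≉0 (begin
      u k * (u k * (v i * w j - v j * w i))
        ≈⟨ solve 5 (λ uₖ vᵢ vⱼ wᵢ wⱼ → uₖ :* (uₖ :* (vᵢ :* wⱼ :- vⱼ :* wᵢ))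
                      := (uₖ :* vᵢ) :* (uₖ :* wⱼ) :- (uₖ :* vⱼ) :* (uₖ :* wᵢ)) refl (u k) (v i) (v j) (w i) (w j) ⟩
      (u k * v i) * (u k * w j) - (u k * v j) * (u k * w i)
        ≈⟨ +-cong (*-cong (parallel⇒*≈* u∥v k i) (parallel⇒*≈* u∥w k j))
                  (-‿cong (*-cong (parallel⇒*≈* u∥v k j) (parallel⇒*≈* u∥w k i))) ⟩
      (u i * v k) * (u j * w k) - (u j * v k) * (u i * w k)
        ≈⟨ solve 4 (λ uᵢ uⱼ vₖ wₖ → (uᵢ :* vₖ) :* (uⱼ :* wₖ) :- (uⱼ :* vₖ) :* (uᵢ :* wₖ) := con (+ 0))
                   refl (u i) (u j) (v k) (w k) ⟩
      0#  ∎)))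

module Matrices {c ℓ} (F : Field c ℓ) where
  open Field F
  open PSL2 F
  open FieldProperties F
  open ThreeVectors commutativeRing
  open IntegerCoefficientSolver commutativeRing
  open import Algebra.Properties.Ring ring using (-‿involutive; -0#≈0#; -1*x≈-x)
  open import Algebra.Properties.Group +-group using (⁻¹-injective)
    renaming (x∙y⁻¹≈ε⇒x≈y to x-y≈0⇒x≈y; x≈y⇒x∙y⁻¹≈ε to x≈y⇒x-y≈0; inverseˡ-unique to x+y≈0⇒x≈-y)
  open import Relation.Binary.Reasoning.Setoid setoid

  private variable M M′ N N′ g : Mat

  -- PSL2._∼_ unfolds to M ≋ N ⊎ M ≋ -ᴹ N.
  infix 4 _≋_
  _≋_ : Mat → Mat → Set ℓ
  M ≋ N = a M ≈ a N × b M ≈ b N × c' M ≈ c' N × d M ≈ d N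

  -ᴹ_ : Mat → Mat
  -ᴹ M = mat (- a M) (- b M) (- c' M) (- d M)

  ≋-refl : M ≋ M
  ≋-refl = refl , refl , refl , refl

  ≋-sym : M ≋ N → N ≋ M
  ≋-sym (p , q , r , s) = sym p , sym q , sym r , sym s

  ≋-trans : M ≋ N → N ≋ N′ → M ≋ N′
  ≋-trans (p , q , r , s) (p′ , q′ , r′ , s′) = trans p p′ , trans q q′ , trans r r′ , trans s s′

  -ᴹ-cong : M ≋ N → -ᴹ M ≋ -ᴹ N
  -ᴹ-cong (p , q , r , s) = -‿cong p , -‿cong q , -‿cong r , -‿cong s

  -ᴹ-involutive : ∀ M → -ᴹ -ᴹ M ≋ M
  -ᴹ-involutive M = -‿involutive _ , -‿involutive _ , -‿involutive _ , -‿involutive _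

  ·-cong : M ≋ M′ → N ≋ N′ → M · N ≋ M′ · N′
  ·-cong (p₁ , p₂ , p₃ , p₄) (q₁ , q₂ , q₃ , q₄) =
    entry p₁ q₁ p₂ q₃ , entry p₁ q₂ p₂ q₄ , entry p₃ q₁ p₄ q₃ , entry p₃ q₂ p₄ q₄
    where
    entry : ∀ {x x′ y y′ z z′ w w′} → x ≈ x′ → y ≈ y′ → z ≈ z′ → w ≈ w′ →
            x * y + z * w ≈ x′ * y′ + z′ * w′
    entry p q r s = +-cong (*-cong p q) (*-cong r s)

  -ᴹ‿distribˡ-· : ∀ M N → (-ᴹ M) · N ≋ -ᴹ (M · N)
  -ᴹ‿distribˡ-· M N = entry (a M) (a N) (b M) (c' N) , entry (a M) (b N) (b M) (d N)
                    , entry (c' M) (a N) (d M) (c' N) , entry (c' M) (b N) (d M) (d N)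
    where
    entry : ∀ x y z w → (- x) * y + (- z) * w ≈ - (x * y + z * w)
    entry = solve 4 (λ x y z w → (:- x) :* y :+ (:- z) :* w := :- (x :* y :+ z :* w)) refl

  -ᴹ‿distribʳ-· : ∀ M N → M · (-ᴹ N) ≋ -ᴹ (M · N)
  -ᴹ‿distribʳ-· M N = entry (a M) (a N) (b M) (c' N) , entry (a M) (b N) (b M) (d N)
                    , entry (c' M) (a N) (d M) (c' N) , entry (c' M) (b N) (d M) (d N)
    where
    entry : ∀ x y z w → x * (- y) + z * (- w) ≈ - (x * y + z * w)
    entry = solve 4 (λ x y z w → x :* (:- y) :+ z :* (:- w) := :- (x :* y :+ z :* w)) refl

  ·-assoc : ∀ M N P → (M · N) · P ≋ M · (N · P)
  ·-assoc M N P = entry (a M) (b M) (a P) (c' P) , entry (a M) (b M) (b P) (d P)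
                , entry (c' M) (d M) (a P) (c' P) , entry (c' M) (d M) (b P) (d P)
    where
    entry : ∀ x y u v → (x * a N + y * c' N) * u + (x * b N + y * d N) * v
                      ≈ x * (a N * u + b N * v) + y * (c' N * u + d N * v)
    entry = λ x y u v → solve 8 (λ x y p q r s u v →
      (x :* p :+ y :* q) :* u :+ (x :* r :+ y :* s) :* v := x :* (p :* u :+ r :* v) :+ y :* (q :* u :+ s :* v))
      refl x y (a N) (c' N) (b N) (d N) u v

  ·-identityˡ : ∀ M → I · M ≋ M
  ·-identityˡ M = entry (a M) (c' M) , entry (b M) (d M) , entry′ (a M) (c' M) , entry′ (b M) (d M)
    where
    entry : ∀ x y → 1# * x + 0# * y ≈ x
    entry = solve 2 (λ x y → con (+ 1) :* x :+ con (+ 0) :* y := x) refl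
    entry′ : ∀ x y → 0# * x + 1# * y ≈ y
    entry′ = solve 2 (λ x y → con (+ 0) :* x :+ con (+ 1) :* y := y) refl

  ·-identityʳ : ∀ M → M · I ≋ M
  ·-identityʳ M = entry (a M) (b M) , entry′ (a M) (b M) , entry (c' M) (d M) , entry′ (c' M) (d M)
    where
    entry : ∀ x y → x * 1# + y * 0# ≈ x
    entry = solve 2 (λ x y → x :* con (+ 1) :+ y :* con (+ 0) := x) refl
    entry′ : ∀ x y → x * 0# + y * 1# ≈ y
    entry′ = solve 2 (λ x y → x :* con (+ 0) :+ y :* con (+ 1) := y) refl

  ∼-refl : M ∼ M
  ∼-refl = inj₁ ≋-refl

  ∼-sym : M ∼ N → N ∼ M
  ∼-sym     (inj₁ M≋N)  = inj₁ (≋-sym M≋N)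
  ∼-sym {N = N} (inj₂ M≋-N) = inj₂ (≋-trans (≋-sym (-ᴹ-involutive N)) (-ᴹ-cong (≋-sym M≋-N)))

  ∼-trans : M ∼ N → N ∼ N′ → M ∼ N′
  ∼-trans (inj₁ p) (inj₁ q) = inj₁ (≋-trans p q)
  ∼-trans (inj₁ p) (inj₂ q) = inj₂ (≋-trans p q)
  ∼-trans (inj₂ p) (inj₁ q) = inj₂ (≋-trans p (-ᴹ-cong q))
  ∼-trans (inj₂ p) (inj₂ q) = inj₁ (≋-trans p (≋-trans (-ᴹ-cong q) (-ᴹ-involutive _)))

  ∼-·-cong : M ∼ M′ → N ∼ N′ → (M · N) ∼ (M′ · N′)
  ∼-·-cong (inj₁ p) (inj₁ q) = inj₁ (·-cong p q)
  ∼-·-cong (inj₁ p) (inj₂ q) = inj₂ (≋-trans (·-cong p q) (-ᴹ‿distribʳ-· _ _))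
  ∼-·-cong (inj₂ p) (inj₁ q) = inj₂ (≋-trans (·-cong p q) (-ᴹ‿distribˡ-· _ _))
  ∼-·-cong {M′ = M′} {N′ = N′} (inj₂ p) (inj₂ q) = inj₁ (≋-trans (·-cong p q)
    (≋-trans (-ᴹ‿distribˡ-· M′ (-ᴹ N′)) (≋-trans (-ᴹ-cong (-ᴹ‿distribʳ-· M′ N′)) (-ᴹ-involutive (M′ · N′)))))

  ±-monoid : Monoid c ℓ
  ±-monoid = record
    { Carrier = Mat ; _≈_ = _∼_ ; _∙_ = _·_ ; ε = I
    ; isMonoid = record
      { isSemigroup = record
        { isMagma = record
          { isEquivalence = record { refl = ∼-refl ; sym = ∼-sym ; trans = ∼-trans }
          ; ∙-cong = ∼-·-cong }
        ; assoc = λ M N P → inj₁ (·-assoc M N P) }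
      ; identity = (λ M → inj₁ (·-identityˡ M)) , (λ M → inj₁ (·-identityʳ M)) } }

  open CommutingElements ±-monoid public

  involutions-order>2 : (M · M) ∼ I → (N · N) ∼ I → ¬ M ∼ N → ¬ Commute M N → OrderGreaterThan (M · N) 2
  involutions-order>2 M²∼I N²∼I M≁N ¬MN≈NM (suc zero) _ _ MN∼I =
    M≁N (∙≈ε⇒≈ N²∼I (∼-trans (inj₁ (≋-sym (·-identityʳ _))) MN∼I))
  involutions-order>2 M²∼I N²∼I M≁N ¬MN≈NM (suc (suc zero)) _ _ [MN]²∼I =
    ¬MN≈NM (involutions-commute M²∼I N²∼I (∼-trans (∼-·-cong ∼-refl (inj₁ (≋-sym (·-identityʳ _)))) [MN]²∼I))
  involutions-order>2 _ _ _ _ (suc (suc (suc _))) _ (ℕ.s≤s (ℕ.s≤s ()))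

  det-· : ∀ M N → det (M · N) ≈ det M * det N
  det-· M N = solve 8 (λ a b c d a′ b′ c′ d′ →
    (a :* a′ :+ b :* c′) :* (c :* b′ :+ d :* d′) :- (a :* b′ :+ b :* d′) :* (c :* a′ :+ d :* c′)
      := (a :* d :- b :* c) :* (a′ :* d′ :- b′ :* c′))
    refl (a M) (b M) (c' M) (d M) (a N) (b N) (c' N) (d N)

  det-cong : M ∼ N → det M ≈ det N
  det-cong (inj₁ (p , q , r , s)) = +-cong (*-cong p s) (-‿cong (*-cong q r))
  det-cong {N = N} (inj₂ (p , q , r , s)) = trans (+-cong (*-cong p s) (-‿cong (*-cong q r)))
    (solve 4 (λ a b c d → (:- a) :* (:- d) :- (:- b) :* (:- c) := a :* d :- b :* c) refl (a N) (b N) (c' N) (d N))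

  InSL-I : InSL I
  InSL-I = solve 0 (con (+ 1) :* con (+ 1) :- con (+ 0) :* con (+ 0) := con (+ 1)) refl

  InSL-· : InSL M → InSL N → InSL (M · N)
  InSL-· {M} {N} det-M det-N = trans (det-· M N) (trans (*-cong det-M det-N) (*-identityˡ 1#))

  InSL-resp : M ∼ N → InSL M → InSL N
  InSL-resp M∼N det-M = trans (sym (det-cong M∼N)) det-M

  InSL-inv : InSL M → InSL (inv M)
  InSL-inv {M} = trans (solve 4 (λ a b c d → d :* a :- (:- b) :* (:- c) := a :* d :- b :* c)
    refl (a M) (b M) (c' M) (d M))

  inv-inverseˡ : InSL M → (inv M · M) ∼ I
  inv-inverseˡ {M} det-M = inj₁
    ( trans (solve 4 (λ a b c d → d :* a :+ (:- b) :* c := a :* d :- b :* c) refl (a M) (b M) (c' M) (d M)) det-M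
    , solve 2 (λ b d → d :* b :+ (:- b) :* d := con (+ 0)) refl (b M) (d M)
    , solve 2 (λ a c → (:- c) :* a :+ a :* c := con (+ 0)) refl (a M) (c' M)
    , trans (solve 4 (λ a b c d → (:- c) :* b :+ a :* d := a :* d :- b :* c) refl (a M) (b M) (c' M) (d M)) det-M )

  inv-inverseʳ : InSL M → (M · inv M) ∼ I
  inv-inverseʳ {M} det-M = inj₁
    ( trans (solve 4 (λ a b c d → a :* d :+ b :* (:- c) := a :* d :- b :* c) refl (a M) (b M) (c' M) (d M)) det-M
    , solve 2 (λ a b → a :* (:- b) :+ b :* a := con (+ 0)) refl (a M) (b M)
    , solve 2 (λ c d → c :* d :+ d :* (:- c) := con (+ 0)) refl (c' M) (d M)
    , trans (solve 4 (λ a b c d → c :* (:- b) :+ d :* a := a :* d :- b :* c) refl (a M) (b M) (c' M) (d M)) det-M )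

  module _ {n} {ρ : Fin n → Mat} (ρ-InSL : ∀ i → InSL (ρ i)) where

    generated-InSL : Generated ρ M → InSL M
    generated-InSL (gen i)  = ρ-InSL i
    generated-InSL one      = InSL-I
    generated-InSL (mul p q) = InSL-· (generated-InSL p) (generated-InSL q)
    generated-InSL (inv' p) = InSL-inv (generated-InSL p)
    generated-InSL (resp e p) = InSL-resp e (generated-InSL p)

    commute-generated : (∀ i → Commute g (ρ i)) → Generated ρ M → Commute g M
    commute-generated g-ρ (gen i)    = g-ρ i
    commute-generated g-ρ one        = commute-ε
    commute-generated g-ρ (mul p q)  = commute-∙ (commute-generated g-ρ p) (commute-generated g-ρ q)
    commute-generated g-ρ (inv' p)   = commute-inverse (inv-inverseˡ (generated-InSL p))
                                         (inv-inverseʳ (generated-InSL p)) (commute-generated g-ρ p)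
    commute-generated g-ρ (resp e p) = commute-resp ∼-refl e (commute-generated g-ρ p)

  IsScalar : Mat → Set ℓ
  IsScalar M = b M ≈ 0# × c' M ≈ 0# × a M ≈ d M

  ∼I⇒scalar : M ∼ I → IsScalar M
  ∼I⇒scalar (inj₁ (a≈1 , b≈0 , c≈0 , d≈1)) = b≈0 , c≈0 , trans a≈1 (sym d≈1)
  ∼I⇒scalar (inj₂ (a≈-1 , b≈-0 , c≈-0 , d≈-1)) = trans b≈-0 -0#≈0# , trans c≈-0 -0#≈0# , trans a≈-1 (sym d≈-1)

  square-scalar⇒scalar : ¬ a M + d M ≈ 0# → IsScalar (M · M) → IsScalar M
  square-scalar⇒scalar {M} t≉0 (b²≈0 , c²≈0 , a²≈d²) =
      x*y≈0⇒y≈0 t≉0 (trans (solve 3 (λ a b d → (a :+ d) :* b := a :* b :+ b :* d) refl (a M) (b M) (d M)) b²≈0)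
    , x*y≈0⇒y≈0 t≉0 (trans (solve 3 (λ a c d → (a :+ d) :* c := c :* a :+ d :* c) refl (a M) (c' M) (d M)) c²≈0)
    , x-y≈0⇒x≈y _ _ (x*y≈0⇒y≈0 t≉0 (trans
        (solve 4 (λ a b c d → (a :+ d) :* (a :- d) := (a :* a :+ b :* c) :- (c :* b :+ d :* d))
          refl (a M) (b M) (c' M) (d M))
        (x≈y⇒x-y≈0 a²≈d²)))

  2≈0⇒∼⇒≋ : 2# ≈ 0# → M ∼ N → M ≋ N
  2≈0⇒∼⇒≋ 2≈0 (inj₁ M≋N)  = M≋N
  2≈0⇒∼⇒≋ 2≈0 (inj₂ M≋-N) = ≋-trans M≋-N (-x≈x , -x≈x , -x≈x , -x≈x)
    where
    -x≈x : ∀ {x} → - x ≈ x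
    -x≈x = sym (2≈0⇒x≈-x 2≈0)

  U : Mat
  U = mat 1# 1# 0# 1#

  InSL-U : InSL U
  InSL-U = solve 0 (con (+ 1) :* con (+ 1) :- con (+ 1) :* con (+ 0) := con (+ 1)) refl

  infix 30 _ᵀ
  _ᵀ : Mat → Mat
  M ᵀ = mat (a M) (c' M) (b M) (d M)

  InSL-ᵀ : InSL M → InSL (M ᵀ)
  InSL-ᵀ = trans (+-congˡ (-‿cong (*-comm _ _)))

  ᵀ-cong : M ∼ N → (M ᵀ) ∼ (N ᵀ)
  ᵀ-cong (inj₁ (p , q , r , s)) = inj₁ (p , r , q , s)
  ᵀ-cong (inj₂ (p , q , r , s)) = inj₂ (p , r , q , s)

  ᵀ-· : ∀ M N → (M · N) ᵀ ≋ N ᵀ · M ᵀ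
  ᵀ-· M N = entry (a M) (a N) (b M) (c' N) , entry (c' M) (a N) (d M) (c' N)
          , entry (a M) (b N) (b M) (d N) , entry (c' M) (b N) (d M) (d N)
    where
    entry : ∀ x y z w → x * y + z * w ≈ y * x + w * z
    entry = solve 4 (λ x y z w → x :* y :+ z :* w := y :* x :+ w :* z) refl

  commute-ᵀ : Commute M N → Commute (M ᵀ) (N ᵀ)
  commute-ᵀ {M} {N} MN∼NM = ∼-trans (inj₁ (≋-sym (ᵀ-· N M))) (∼-trans (ᵀ-cong (∼-sym MN∼NM)) (inj₁ (ᵀ-· M N)))

  commute-U-exact : (g · U) ≋ (U · g) → c' g ≈ 0# × a g ≈ d g
  commute-U-exact {g} (e₁ , e₂ , _ , _) =
      trans (solve 4 (λ a b c d → c := (con (+ 1) :* a :+ con (+ 1) :* c) :- (a :* con (+ 1) :+ b :* con (+ 0)))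
               refl (a g) (b g) (c' g) (d g)) (x≈y⇒x-y≈0 (sym e₁))
    , x-y≈0⇒x≈y _ _ (trans (solve 3 (λ a b d → a :- d := (a :* con (+ 1) :+ b :* con (+ 1)) :- (con (+ 1) :* b :+ con (+ 1) :* d))
               refl (a g) (b g) (d g)) (x≈y⇒x-y≈0 e₂))

  anticommute-U : ¬ 2# ≈ 0# → (g · U) ≋ -ᴹ (U · g) → ¬ InSL g
  anticommute-U {g} 2≉0 (e₁ , _ , e₃ , _) det≈1 = 1≉0 (begin
    1#                      ≈⟨ det≈1 ⟨
    a g * d g - b g * c' g  ≈⟨ +-cong (*-congʳ a≈0) (-‿cong (*-congˡ c≈0)) ⟩
    0# * d g - b g * 0#     ≈⟨ solve 2 (λ d b → con (+ 0) :* d :- b :* con (+ 0) := con (+ 0)) refl (d g) (b g) ⟩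
    0#                      ∎)
    where
    c≈0 : c' g ≈ 0#
    c≈0 = x+x≈0⇒x≈0 2≉0 (trans
      (solve 3 (λ a c d → c :+ c := (c :* con (+ 1) :+ d :* con (+ 0)) :+ (con (+ 0) :* a :+ con (+ 1) :* c))
        refl (a g) (c' g) (d g))
      (x≈-y⇒x+y≈0 e₃))
    a≈0 : a g ≈ 0#
    a≈0 = x+x≈0⇒x≈0 2≉0 (begin
      a g + a g    ≈⟨ solve 3 (λ a b c → a :+ a := ((a :* con (+ 1) :+ b :* con (+ 0)) :+ (con (+ 1) :* a :+ con (+ 1) :* c)) :- c)
                        refl (a g) (b g) (c' g) ⟩
      _ - c' g     ≈⟨ +-cong (x≈-y⇒x+y≈0 e₁) (-‿cong c≈0) ⟩
      0# - 0#      ≈⟨ -‿inverseʳ 0# ⟩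
      0#           ∎)

  traceless : Vector Carrier 3 → Mat
  traceless u = mat (u 0F) (u 1F) (u 2F) (- u 0F)

  coordinates : Mat → Vector Carrier 3
  coordinates M = a M ∷ b M ∷ c' M ∷ []

  traceless-coordinates : a M + d M ≈ 0# → M ≋ traceless (coordinates M)
  traceless-coordinates {M} t≈0 = refl , refl , refl , x+y≈0⇒x≈-y (d M) (a M) (trans (+-comm _ _) t≈0)

  private variable u v w : Vector Carrier 3

  -- Taking w = λ i → - v i, the conclusion is definitionally traceless u ≋ -ᴹ traceless v.
  traceless-cong : (∀ i → u i ≈ w i) → traceless u ≋ traceless w
  traceless-cong u≈w = u≈w 0F , u≈w 1F , u≈w 2F , -‿cong (u≈w 0F)

  norm : Vector Carrier 3 → Carrier
  norm u = u 0F * u 0F + u 1F * u 2F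

  InSL⇒norm≈-1 : InSL (traceless u) → norm u ≈ - 1#
  InSL⇒norm≈-1 {u} det≈1 = x+y≈0⇒x≈-y _ _ (begin
    norm u + 1#                             ≈⟨ +-congˡ det≈1 ⟨
    norm u + (u 0F * - u 0F - u 1F * u 2F)  ≈⟨ solve 3 (λ a b c → (a :* a :+ b :* c) :+ (a :* (:- a) :- b :* c) := con (+ 0))
                                                 refl (u 0F) (u 1F) (u 2F) ⟩
    0#                                      ∎)

  *-norm≈- : InSL (traceless u) → ∀ x → x * norm u ≈ - x
  *-norm≈- {u} det≈1 x = trans (*-congˡ (InSL⇒norm≈-1 {u} det≈1)) (solve 1 (λ x → x :* (:- con (+ 1)) := :- x) refl x)

  -- For parallel u, v this is half of dot (dual u) v, and it equals λ * norm u when v = λ u.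
  ratio : Vector Carrier 3 → Vector Carrier 3 → Carrier
  ratio u v = u 0F * v 0F + v 1F * u 2F

  ratio-scales : InSL (traceless u) → Parallel u v → ∀ i → ratio u v * u i ≈ - v i
  ratio-scales {u} {v} det≈1 u∥v i = trans (scaled i) (*-norm≈- {u} det≈1 (v i))
    where
    u₀ u₁ u₂ v₀ v₁ v₂ : Carrier
    u₀ = u 0F ; u₁ = u 1F ; u₂ = u 2F ; v₀ = v 0F ; v₁ = v 1F ; v₂ = v 2F
    uv≈uv : ∀ i j → u i * v j ≈ u j * v i
    uv≈uv = parallel⇒*≈* u∥v
    scaled : ∀ i → ratio u v * u i ≈ v i * norm u
    scaled 0F = begin
      ratio u v * u₀
        ≈⟨ solve 4 (λ u₀ u₂ v₀ v₁ → (u₀ :* v₀ :+ v₁ :* u₂) :* u₀ := u₀ :* u₀ :* v₀ :+ u₂ :* (u₀ :* v₁))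
                   refl u₀ u₂ v₀ v₁ ⟩
      u₀ * u₀ * v₀ + u₂ * (u₀ * v₁)
        ≈⟨ +-congˡ (*-congˡ (uv≈uv 0F 1F)) ⟩
      u₀ * u₀ * v₀ + u₂ * (u₁ * v₀)
        ≈⟨ solve 4 (λ u₀ u₁ u₂ v₀ → u₀ :* u₀ :* v₀ :+ u₂ :* (u₁ :* v₀) := v₀ :* (u₀ :* u₀ :+ u₁ :* u₂))
                   refl u₀ u₁ u₂ v₀ ⟩
      v₀ * norm u
        ∎
    scaled 1F = begin
      ratio u v * u₁
        ≈⟨ solve 5 (λ u₀ u₁ u₂ v₀ v₁ → (u₀ :* v₀ :+ v₁ :* u₂) :* u₁ := u₀ :* (u₁ :* v₀) :+ v₁ :* (u₁ :* u₂))
                   refl u₀ u₁ u₂ v₀ v₁ ⟩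
      u₀ * (u₁ * v₀) + v₁ * (u₁ * u₂)
        ≈⟨ +-congʳ (*-congˡ (uv≈uv 1F 0F)) ⟩
      u₀ * (u₀ * v₁) + v₁ * (u₁ * u₂)
        ≈⟨ solve 4 (λ u₀ u₁ u₂ v₁ → u₀ :* (u₀ :* v₁) :+ v₁ :* (u₁ :* u₂) := v₁ :* (u₀ :* u₀ :+ u₁ :* u₂))
                   refl u₀ u₁ u₂ v₁ ⟩
      v₁ * norm u
        ∎
    scaled 2F = begin
      ratio u v * u₂
        ≈⟨ solve 4 (λ u₀ u₂ v₀ v₁ → (u₀ :* v₀ :+ v₁ :* u₂) :* u₂ := u₀ :* (u₂ :* v₀) :+ u₂ :* (u₂ :* v₁))
                   refl u₀ u₂ v₀ v₁ ⟩
      u₀ * (u₂ * v₀) + u₂ * (u₂ * v₁)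
        ≈⟨ +-cong (*-congˡ (uv≈uv 2F 0F)) (*-congˡ (uv≈uv 2F 1F)) ⟩
      u₀ * (u₀ * v₂) + u₂ * (u₁ * v₂)
        ≈⟨ solve 4 (λ u₀ u₁ u₂ v₂ → u₀ :* (u₀ :* v₂) :+ u₂ :* (u₁ :* v₂) := v₂ :* (u₀ :* u₀ :+ u₁ :* u₂))
                   refl u₀ u₁ u₂ v₂ ⟩
      v₂ * norm u
        ∎

  ratio²≈1 : InSL (traceless u) → InSL (traceless v) → Parallel u v → ratio u v * ratio u v ≈ 1#
  ratio²≈1 {u} {v} det-u det-v u∥v = begin
    r * r                                          ≈⟨ -‿involutive (r * r) ⟨
    - - (r * r)                                    ≈⟨ -‿cong (*-norm≈- {u} det-u (r * r)) ⟨
    - (r * r * norm u)                             ≈⟨ -‿cong (solve 4 (λ r u₀ u₁ u₂ →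
                                                        r :* r :* (u₀ :* u₀ :+ u₁ :* u₂)
                                                          := (r :* u₀) :* (r :* u₀) :+ (r :* u₁) :* (r :* u₂))
                                                        refl r (u 0F) (u 1F) (u 2F)) ⟩
    - ((r * u 0F) * (r * u 0F) + (r * u 1F) * (r * u 2F))
                                                   ≈⟨ -‿cong (+-cong (*-cong (ru≈-v 0F) (ru≈-v 0F))
                                                                     (*-cong (ru≈-v 1F) (ru≈-v 2F))) ⟩
    - ((- v 0F) * (- v 0F) + (- v 1F) * (- v 2F))  ≈⟨ -‿cong (solve 3 (λ v₀ v₁ v₂ →
                                                        (:- v₀) :* (:- v₀) :+ (:- v₁) :* (:- v₂) := v₀ :* v₀ :+ v₁ :* v₂)
                                                        refl (v 0F) (v 1F) (v 2F)) ⟩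
    - norm v                                       ≈⟨ -‿cong (InSL⇒norm≈-1 {v} det-v) ⟩
    - - 1#                                         ≈⟨ -‿involutive 1# ⟩
    1#                                             ∎
    where
    r : Carrier
    r = ratio u v
    ru≈-v : ∀ i → r * u i ≈ - v i
    ru≈-v = ratio-scales {u} {v} det-u u∥v

  -- dot (dual u) v = 2u₀v₀ + u₁v₂ + u₂v₁ is the polar form of norm u = - det (traceless u).
  dual : Vector Carrier 3 → Vector Carrier 3
  dual u = 2# * u 0F ∷ u 2F ∷ u 1F ∷ []

  dual-parallel⇒parallel : ¬ 2# ≈ 0# → Parallel (dual u) (dual v) → Parallel u v
  dual-parallel⇒parallel {u} {v} 2≉0 (parallel du×dv≈0) = parallel λ where
      0F → trans (solve 4 (λ u₁ u₂ v₁ v₂ → u₁ :* v₂ :- u₂ :* v₁ := :- (u₂ :* v₁ :- u₁ :* v₂))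
                    refl (u 1F) (u 2F) (v 1F) (v 2F))
                 (trans (-‿cong (du×dv≈0 0F)) -0#≈0#)
      1F → x+x≈0⇒x≈0 2≉0 (trans (solve 4 (λ u₀ u₂ v₀ v₂ → (u₂ :* v₀ :- u₀ :* v₂) :+ (u₂ :* v₀ :- u₀ :* v₂)
                                              := :- ((con (+ 2) :* u₀) :* v₂ :- u₂ :* (con (+ 2) :* v₀)))
                                     refl (u 0F) (u 2F) (v 0F) (v 2F))
                            (trans (-‿cong (du×dv≈0 2F)) -0#≈0#))
      2F → x+x≈0⇒x≈0 2≉0 (trans (solve 4 (λ u₀ u₁ v₀ v₁ → (u₀ :* v₁ :- u₁ :* v₀) :+ (u₀ :* v₁ :- u₁ :* v₀)
                                              := :- (u₁ :* (con (+ 2) :* v₀) :- (con (+ 2) :* u₀) :* v₁))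
                                     refl (u 0F) (u 1F) (v 0F) (v 1F))
                            (trans (-‿cong (du×dv≈0 1F)) -0#≈0#))

  cross₀≈commutator₁₁ : cross u v 0F ≈ a (traceless u · traceless v) - a (traceless v · traceless u)
  cross₀≈commutator₁₁ {u} {v} = solve 6 (λ u₀ u₁ u₂ v₀ v₁ v₂ →
    u₁ :* v₂ :- u₂ :* v₁ := (u₀ :* v₀ :+ u₁ :* v₂) :- (v₀ :* u₀ :+ v₁ :* u₂))
    refl (u 0F) (u 1F) (u 2F) (v 0F) (v 1F) (v 2F)

  commute⇒parallel⊎orthogonal : ¬ 2# ≈ 0# → Commute (traceless u) (traceless v) →
                                Parallel u v ⊎ dot (dual u) v ≈ 0#
  commute⇒parallel⊎orthogonal {u} {v} 2≉0 (inj₁ (e₁ , e₂ , e₃ , _)) = inj₁ (parallel λ where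
      0F → trans (cross₀≈commutator₁₁ {u} {v}) (x≈y⇒x-y≈0 e₁)
      1F → x+x≈0⇒x≈0 2≉0 (trans (solve 4 (λ u₀ u₂ v₀ v₂ → (u₂ :* v₀ :- u₀ :* v₂) :+ (u₂ :* v₀ :- u₀ :* v₂)
                                              := (u₂ :* v₀ :+ (:- u₀) :* v₂) :- (v₂ :* u₀ :+ (:- v₀) :* u₂))
                                     refl (u 0F) (u 2F) (v 0F) (v 2F))
                            (x≈y⇒x-y≈0 e₃))
      2F → x+x≈0⇒x≈0 2≉0 (trans (solve 4 (λ u₀ u₁ v₀ v₁ → (u₀ :* v₁ :- u₁ :* v₀) :+ (u₀ :* v₁ :- u₁ :* v₀)
                                              := (u₀ :* v₁ :+ u₁ :* (:- v₀)) :- (v₀ :* u₁ :+ v₁ :* (:- u₀)))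
                                     refl (u 0F) (u 1F) (v 0F) (v 1F))
                            (x≈y⇒x-y≈0 e₂)))
  commute⇒parallel⊎orthogonal {u} {v} 2≉0 (inj₂ (e₁ , _)) = inj₂ (trans
    (solve 6 (λ u₀ u₁ u₂ v₀ v₁ v₂ → (con (+ 2) :* u₀) :* v₀ :+ u₂ :* v₁ :+ u₁ :* v₂
                                    := (u₀ :* v₀ :+ u₁ :* v₂) :+ (v₀ :* u₀ :+ v₁ :* u₂))
      refl (u 0F) (u 1F) (u 2F) (v 0F) (v 1F) (v 2F))
    (x≈-y⇒x+y≈0 e₁))

  offDiagonal : Vector Carrier 3 → Vector Carrier 3
  offDiagonal u = 0# ∷ u 1F ∷ u 2F ∷ []

  commute⇒parallel-offDiagonal : 2# ≈ 0# → Commute (traceless u) (traceless v) →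
                                 Parallel (offDiagonal u) (offDiagonal v)
  commute⇒parallel-offDiagonal {u} {v} 2≈0 uv∼vu with 2≈0⇒∼⇒≋ 2≈0 uv∼vu
  ... | e₁ , _ = parallel λ where
      0F → trans (cross₀≈commutator₁₁ {u} {v}) (x≈y⇒x-y≈0 e₁)
      1F → solve 2 (λ u₂ v₂ → u₂ :* con (+ 0) :- con (+ 0) :* v₂ := con (+ 0)) refl (u 2F) (v 2F)
      2F → solve 2 (λ u₁ v₁ → con (+ 0) :* v₁ :- u₁ :* con (+ 0) := con (+ 0)) refl (u 1F) (v 1F)

  parallel-offDiagonal⇒commute : 2# ≈ 0# → Parallel (offDiagonal u) (offDiagonal v) →
                                 Commute (traceless u) (traceless v)
  parallel-offDiagonal⇒commute {u} {v} 2≈0 (parallel ou×ov≈0) = inj₁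
    ( x-y≈0⇒x≈y _ _ (trans (sym (cross₀≈commutator₁₁ {u} {v})) (ou×ov≈0 0F))
    , x-y≈0⇒x≈y _ _ (trans (solve 4 (λ u₀ u₁ v₀ v₁ →
        (u₀ :* v₁ :+ u₁ :* (:- v₀)) :- (v₀ :* u₁ :+ v₁ :* (:- u₀)) := con (+ 2) :* (u₀ :* v₁ :- u₁ :* v₀))
        refl u₀ u₁ v₀ v₁)
        (2x≈0 _))
    , x-y≈0⇒x≈y _ _ (trans (solve 4 (λ u₀ u₂ v₀ v₂ →
        (u₂ :* v₀ :+ (:- u₀) :* v₂) :- (v₂ :* u₀ :+ (:- v₀) :* u₂) := con (+ 2) :* (u₂ :* v₀ :- u₀ :* v₂))
        refl u₀ u₂ v₀ v₂)
        (2x≈0 _))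
    , x-y≈0⇒x≈y _ _ (trans (solve 6 (λ u₀ u₁ u₂ v₀ v₁ v₂ →
        (u₂ :* v₁ :+ (:- u₀) :* (:- v₀)) :- (v₂ :* u₁ :+ (:- v₀) :* (:- u₀)) := :- (u₁ :* v₂ :- u₂ :* v₁))
        refl u₀ u₁ u₂ v₀ v₁ v₂) (trans (-‿cong (ou×ov≈0 0F)) -0#≈0#)) )
    where
    u₀ u₁ u₂ v₀ v₁ v₂ : Carrier
    u₀ = u 0F ; u₁ = u 1F ; u₂ = u 2F ; v₀ = v 0F ; v₁ = v 1F ; v₂ = v 2F
    2x≈0 : ∀ x → 2# * x ≈ 0#
    2x≈0 x = trans (*-congʳ 2≈0) (zeroˡ x)

  module _ (_≟_ : Decidable _≈_) where

    scalar⇒∼I : InSL M → IsScalar M → M ∼ I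
    scalar⇒∼I {M} det≈1 (b≈0 , c≈0 , a≈d) with x*x≈1⇒x≈±1 _≟_ a²≈1
      where
      a²≈1 : a M * a M ≈ 1#
      a²≈1 = begin
        a M * a M               ≈⟨ *-congˡ a≈d ⟩
        a M * d M               ≈⟨ solve 2 (λ x y → x := x :- con (+ 0) :* y) refl (a M * d M) (c' M) ⟩
        a M * d M - 0# * c' M   ≈⟨ +-congˡ (-‿cong (*-congʳ b≈0)) ⟨
        a M * d M - b M * c' M  ≈⟨ det≈1 ⟩
        1#                      ∎
    ... | inj₁ a≈1  = inj₁ (a≈1 , b≈0 , c≈0 , trans (sym a≈d) a≈1)
    ... | inj₂ a≈-1 = inj₂ (a≈-1 , trans b≈0 (sym -0#≈0#) , trans c≈0 (sym -0#≈0#) , trans (sym a≈d) a≈-1)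

    involution-traceless : InSL M → IsInvolution M → M ∼ traceless (coordinates M)
    involution-traceless {M} det≈1 (M²∼I , M≁I) with (a M + d M) ≟ 0#
    ... | yes t≈0 = inj₁ (traceless-coordinates t≈0)
    ... | no  t≉0 = ⊥-elim (M≁I (scalar⇒∼I det≈1 (square-scalar⇒scalar t≉0 (∼I⇒scalar M²∼I))))

    commute-U : InSL g → Commute g U → c' g ≈ 0# × a g ≈ d g
    commute-U det≈1 (inj₁ gU≋Ug) = commute-U-exact gU≋Ug
    commute-U det≈1 (inj₂ gU≋-Ug) with 2# ≟ 0#
    ... | yes 2≈0 = commute-U-exact (2≈0⇒∼⇒≋ 2≈0 (inj₂ gU≋-Ug))
    ... | no  2≉0 = ⊥-elim (anticommute-U 2≉0 gU≋-Ug det≈1)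

    central⇒∼I : InSL g → (∀ M → InSL M → Commute g M) → g ∼ I
    central⇒∼I {g} det≈1 central = scalar⇒∼I det≈1 (b≈0 , c≈0 , a≈d)
      where
      c≈0 : c' g ≈ 0#
      c≈0 = proj₁ (commute-U det≈1 (central U InSL-U))
      a≈d : a g ≈ d g
      a≈d = proj₂ (commute-U det≈1 (central U InSL-U))
      b≈0 : b g ≈ 0#
      b≈0 = proj₁ (commute-U (InSL-ᵀ det≈1) (commute-ᵀ (central (U ᵀ) (InSL-ᵀ InSL-U))))

    parallel⇒∼ : InSL (traceless u) → InSL (traceless v) → Parallel u v → traceless u ∼ traceless v
    parallel⇒∼ {u} {v} det-u det-v u∥v = ratio≈±1⇒∼ (x*x≈1⇒x≈±1 _≟_ (ratio²≈1 {u} {v} det-u det-v u∥v))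
      where
      ratio≈±1⇒∼ : ratio u v ≈ 1# ⊎ ratio u v ≈ - 1# → traceless u ∼ traceless v
      ratio≈±1⇒∼ (inj₁ r≈1)  = inj₂ (traceless-cong λ i →
        trans (sym (trans (*-congʳ r≈1) (*-identityˡ (u i)))) (ratio-scales {u} {v} det-u u∥v i))
      ratio≈±1⇒∼ (inj₂ r≈-1) = inj₁ (traceless-cong λ i →
        ⁻¹-injective (trans (sym (trans (*-congʳ r≈-1) (-1*x≈-x (u i)))) (ratio-scales {u} {v} det-u u∥v i)))

    commute⇒orthogonal : ¬ 2# ≈ 0# → InSL (traceless u) → InSL (traceless v) →
                         ¬ traceless u ∼ traceless v → Commute (traceless u) (traceless v) → dot (dual u) v ≈ 0#
    commute⇒orthogonal {u} {v} 2≉0 det-u det-v u≁v uv∼vu with commute⇒parallel⊎orthogonal {u} {v} 2≉0 uv∼vu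
    ... | inj₁ u∥v = ⊥-elim (u≁v (parallel⇒∼ det-u det-v u∥v))
    ... | inj₂ u⊥v = u⊥v

    orthogonal-to-both⇒∼ : ∀ {u₀ u₁ v w} → ¬ 2# ≈ 0# →
      InSL (traceless u₀) → InSL (traceless u₁) → InSL (traceless v) → InSL (traceless w) →
      ¬ traceless u₀ ∼ traceless u₁ →
      dot (dual u₀) v ≈ 0# → dot (dual u₁) v ≈ 0# → dot (dual u₀) w ≈ 0# → dot (dual u₁) w ≈ 0# →
      traceless v ∼ traceless w
    orthogonal-to-both⇒∼ {u₀} {u₁} {v} {w} 2≉0 det₀ det₁ det-v det-w u₀≁u₁ u₀⊥v u₁⊥v u₀⊥w u₁⊥w =
      v∼w (Fin.¬∀⟶∃¬ 3 (λ k → cross p q k ≈ 0#) (λ k → cross p q k ≟ 0#) p∦q)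
      where
      p q : Vector Carrier 3
      p = dual u₀
      q = dual u₁
      p∦q : ¬ (∀ k → cross p q k ≈ 0#)
      p∦q p×q≈0 = u₀≁u₁ (parallel⇒∼ {u₀} {u₁} det₀ det₁
                            (dual-parallel⇒parallel {u₀} {u₁} 2≉0 (parallel p×q≈0)))
      v∼w : Σ (Fin 3) (λ k → ¬ cross p q k ≈ 0#) → traceless v ∼ traceless w
      v∼w (k , nₖ≉0) = parallel⇒∼ {v} {w} det-v det-w (parallel-trans {cross p q} {v} {w} k nₖ≉0
        (parallel-cross {p} {q} u₀⊥v u₁⊥v) (parallel-cross {p} {q} u₀⊥w u₁⊥w))

    commute-trans-char2 : ∀ {t u v} → 2# ≈ 0# → InSL (traceless t) → ¬ traceless t ∼ I →
      Commute (traceless t) (traceless u) → Commute (traceless t) (traceless v) →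
      Commute (traceless u) (traceless v)
    commute-trans-char2 {t} {u} {v} 2≈0 det-t t≁I tu∼ut tv∼vt =
      u∼v (Fin.¬∀⟶∃¬ 3 (λ k → offDiagonal t k ≈ 0#) (λ k → offDiagonal t k ≟ 0#) t-not-scalar)
      where
      t-not-scalar : ¬ (∀ k → offDiagonal t k ≈ 0#)
      t-not-scalar t≈0 = t≁I (scalar⇒∼I det-t (t≈0 1F , t≈0 2F , 2≈0⇒x≈-x 2≈0))
      u∼v : Σ (Fin 3) (λ k → ¬ offDiagonal t k ≈ 0#) → Commute (traceless u) (traceless v)
      u∼v (k , tₖ≉0) = parallel-offDiagonal⇒commute {u} {v} 2≈0
        (parallel-trans {offDiagonal t} {offDiagonal u} {offDiagonal v} k tₖ≉0
          (commute⇒parallel-offDiagonal {t} {u} 2≈0 tu∼ut) (commute⇒parallel-offDiagonal {t} {v} 2≈0 tv∼vt))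

inject₁≢suc : ∀ {n} (i : Fin n) → ¬ inject₁ i ≡ fsuc i
inject₁≢suc i i≡1+i = ℕ.1+n≢n (≡.trans (≡.sym (≡.cong Fin.toℕ i≡1+i)) (Fin.toℕ-inject₁ i))

module _ {c ℓ} (F : Field c ℓ) where
  open Field F

  cardinality⇒decidable : ∀ {q} → HasCardinality F q → Decidable _≈_
  cardinality⇒decidable (e , e-injective , e-surjective) x y with e-surjective x | e-surjective y
  ... | i , eᵢ≈x | j , eⱼ≈y with i Fin.≟ j
  ...   | yes ≡.refl = yes (trans (sym eᵢ≈x) eⱼ≈y)
  ...   | no  i≢j    = no λ x≈y → i≢j (e-injective i j (trans eᵢ≈x (trans x≈y (sym eⱼ≈y))))

  open PSL2 F
  open FieldProperties F
  open ThreeVectors commutativeRing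
  open Matrices F

  module RankFourString
    (_≟_ : Decidable _≈_) (ρ : Fin 4 → Mat)
    (ρ-InSL : ∀ i → InSL (ρ i))
    (ρ-involution : ∀ i → IsInvolution (ρ i))
    (ρ-distinct : ∀ i j → ¬ i ≡ j → ¬ ρ i ∼ ρ j)
    (ρ-generates : Generates ρ)
    (ρ-commute : ∀ i j → suc (Fin.toℕ i) < Fin.toℕ j ⊎ suc (Fin.toℕ j) < Fin.toℕ i → Commute (ρ i) (ρ j))
    where

    τ : Fin 4 → Vector Carrier 3
    τ j = coordinates (ρ j)

    ρ∼τ : ∀ j → ρ j ∼ traceless (τ j)
    ρ∼τ j = involution-traceless _≟_ (ρ-InSL j) (ρ-involution j)

    τ-InSL : ∀ j → InSL (traceless (τ j))
    τ-InSL j = InSL-resp (ρ∼τ j) (ρ-InSL j)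

    τ-distinct : ∀ j k → ¬ j ≡ k → ¬ traceless (τ j) ∼ traceless (τ k)
    τ-distinct j k j≢k τⱼ∼τₖ = ρ-distinct j k j≢k (∼-trans (ρ∼τ j) (∼-trans τⱼ∼τₖ (∼-sym (ρ∼τ k))))

    τ-commute : ∀ {j k} → Commute (ρ j) (ρ k) → Commute (traceless (τ j)) (traceless (τ k))
    τ-commute = commute-resp (ρ∼τ _) (ρ∼τ _)

    ρ₀ρ₂ : Commute (ρ 0F) (ρ 2F)
    ρ₀ρ₂ = ρ-commute 0F 2F (inj₁ (ℕ.s≤s (ℕ.s≤s ℕ.z≤n)))

    ρ₀ρ₃ : Commute (ρ 0F) (ρ 3F)
    ρ₀ρ₃ = ρ-commute 0F 3F (inj₁ (ℕ.s≤s (ℕ.s≤s ℕ.z≤n)))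

    ρ₁ρ₃ : Commute (ρ 1F) (ρ 3F)
    ρ₁ρ₃ = ρ-commute 1F 3F (inj₁ (ℕ.s≤s (ℕ.s≤s (ℕ.s≤s ℕ.z≤n))))

    not-central : ∀ j → ¬ (∀ k → Commute (ρ j) (ρ k))
    not-central j ρⱼ-central = proj₂ (ρ-involution j) (central⇒∼I _≟_ (ρ-InSL j)
      λ M det-M → commute-generated ρ-InSL ρⱼ-central (ρ-generates M det-M))

    ¬commute₀₁ : ¬ Commute (ρ 0F) (ρ 1F)
    ¬commute₀₁ ρ₀ρ₁ = not-central 0F λ where
      0F → ∼-refl
      1F → ρ₀ρ₁
      2F → ρ₀ρ₂
      3F → ρ₀ρ₃

    ¬commute₂₃ : ¬ Commute (ρ 2F) (ρ 3F)
    ¬commute₂₃ ρ₂ρ₃ = not-central 3F λ where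
      0F → ∼-sym ρ₀ρ₃
      1F → ∼-sym ρ₁ρ₃
      2F → ∼-sym ρ₂ρ₃
      3F → ∼-refl

    orthogonal : ¬ 2# ≈ 0# → ∀ j k → ¬ j ≡ k → Commute (ρ j) (ρ k) → dot (dual (τ j)) (τ k) ≈ 0#
    orthogonal 2≉0 j k j≢k ρⱼρₖ = commute⇒orthogonal _≟_ {τ j} {τ k} 2≉0 (τ-InSL j) (τ-InSL k)
                                    (τ-distinct j k j≢k) (τ-commute ρⱼρₖ)

    ¬commute₁₂ : ¬ Commute (ρ 1F) (ρ 2F)
    ¬commute₁₂ ρ₁ρ₂ with 2# ≟ 0#
    ... | yes 2≈0 = ¬commute₀₁ (commute-resp (∼-sym (ρ∼τ 0F)) (∼-sym (ρ∼τ 1F))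
                      (commute-trans-char2 _≟_ {τ 2F} {τ 0F} {τ 1F} 2≈0 (τ-InSL 2F)
                        (λ τ₂∼I → proj₂ (ρ-involution 2F) (∼-trans (ρ∼τ 2F) τ₂∼I))
                        (τ-commute (∼-sym ρ₀ρ₂)) (τ-commute (∼-sym ρ₁ρ₂))))
    ... | no  2≉0 = τ-distinct 2F 3F (λ ())
                      (orthogonal-to-both⇒∼ _≟_ {τ 0F} {τ 1F} {τ 2F} {τ 3F} 2≉0
                        (τ-InSL 0F) (τ-InSL 1F) (τ-InSL 2F) (τ-InSL 3F) (τ-distinct 0F 1F (λ ()))
                        (orthogonal 2≉0 0F 2F (λ ()) ρ₀ρ₂) (orthogonal 2≉0 1F 2F (λ ()) ρ₁ρ₂)
                        (orthogonal 2≉0 0F 3F (λ ()) ρ₀ρ₃) (orthogonal 2≉0 1F 3F (λ ()) ρ₁ρ₃))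

    ¬commute-adjacent : ∀ i → ¬ Commute (ρ (inject₁ i)) (ρ (fsuc i))
    ¬commute-adjacent 0F = ¬commute₀₁
    ¬commute-adjacent 1F = ¬commute₁₂
    ¬commute-adjacent 2F = ¬commute₂₃

    adjacent-order>2 : (i : Fin 3) → OrderGreaterThan (ρ (inject₁ i) · ρ (fsuc i)) 2
    adjacent-order>2 i = involutions-order>2 (proj₁ (ρ-involution _)) (proj₁ (ρ-involution _))
                           (ρ-distinct _ _ (inject₁≢suc i)) (¬commute-adjacent i)

mainTheorem2 : (q : ℕ) → IsPrimePower q → 3 < q →
    (F : Field 0ℓ 0ℓ) → HasCardinality F q →
    (ρ : Fin 4 → PSL2.Mat F) → PSL2.IsStringRep F 4 ρ →
    (i : Fin 3) → PSL2.OrderGreaterThan F (PSL2._·_ F (ρ (inject₁ i)) (ρ (fsuc i))) 2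
mainTheorem2 q _ _ F card ρ (ρ-InSL , ρ-involution , ρ-distinct , ρ-generates , ρ-commute) =
  RankFourString.adjacent-order>2 F (cardinality⇒decidable F card) ρ
    ρ-InSL ρ-involution ρ-distinct ρ-generates ρ-commute
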